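{- For any integer $k\geq1$ and any lattice path $x\in L_{2k,k}\setminus D_{2k}^k$ we have $\mathrm{pos}(h,g(x))<\mathrm{pos}(g,x)$, and neither in $x$ nor in $g(x)$ is there an up-step touching the line $y=1$ at any position $i$ with $\mathrm{pos}(h,g(x))<i<\mathrm{pos}(g,x)$.
   Context: A lattice path with $n$ steps is a sequence $x=(x_1,\ldots,x_n)$ of steps, each either an up-step $(1,1)$ or a down-step $(1,-1)$, drawn in $\mathbb{Z}^2$ starting at the origin; step $x_i$ (at position $i$) goes from $(i-1,h_{i-1})$ to $(i,h_i)$. A step lies below the line $y=c$ if both of its endpoints have $y$-coordinate at most $c$. A step touches the line $y=c$ if it starts or ends on that line. For $c\in\mathbb{Z}$, $u_c(x)$ and $d_c(x)$ denote the number of up-steps, respectively down-steps, of $x$ that start on the line $y=c$. Let $L_{2k,k}$ (resp. $L_{2k,k+1}$) be the set of lattice paths with $2k$ steps of which exactly $k$ (resp. $k+1$) are up-steps. $D_{2k}^e$ is the set of paths in $L_{2k,k}$ having exactly $e$ down-steps below the line $y=0$. For $x\in L_{2k,k}\setminus D_{2k}^k$, $g(x)$ is obtained from $x$ by replacing by an up-step the $(d_0(x)+1)$-th (from the left) down-step of $x$ touching the line $y=0$. For $x\in L_{2k,k+1}$, $h(x)$ is obtained from $x$ by replacing by a down-step the $u_1(x)$-th (from the left) up-step of $x$ touching the line $y=1$. For $\gamma\in\{g,h\}$ and $x$ in its domain, $\mathrm{pos}(\gamma,x)\in\{1,\ldots,2k\}$ is the unique position in which $x$ and $\gamma(x)$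 differ. -}

module Defs where

open import Data.Bool using (Bool; true; false; _∧_; _∨_; not; if_then_else_)
open import Data.Nat using (ℕ; zero; suc)
open import Data.Integer using (ℤ; +_; _+_; _-_; _≤ᵇ_)
open import Data.List using (List; []; _∷_; length; filterᵇ; map)
open import Data.Maybe using (Maybe; just; nothing)
open import Relation.Nullary.Decidable using (⌊_⌋)
import Data.Integer.Properties as ℤP
open import Data.Bool using (T)
open import Data.Product using (_×_)
open import Data.List.Relation.Unary.Any using (Any)
open import Relation.Binary.PropositionalEquality using (_≡_)

-- A lattice path is a list of steps: true = up-step (1,1), false = down-step (1,-1).
Path : Set
Path = List Bool

-- Information about one step: position (1-based), up?, start height, end height.
record Step : Set where
  constructor step
  field
    pos   : ℕ
    up    : Bool
    start : ℤ
    end   : ℤ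
open Step public

stepsFrom : ℕ → ℤ → Path → List Step
stepsFrom i h [] = []
stepsFrom i h (b ∷ bs) = step i b h h' ∷ stepsFrom (suc i) h' bs
  where
  h' : ℤ
  h' = if b then h + + 1 else h - + 1

steps : Path → List Step
steps x = stepsFrom 1 (+ 0) x

_==ℤ_ : ℤ → ℤ → Bool
a ==ℤ b = ⌊ a ℤP.≟ b ⌋

startsOn : ℤ → Step → Bool
startsOn c s = start s ==ℤ c

touches : ℤ → Step → Bool
touches c s = (start s ==ℤ c) ∨ (end s ==ℤ c)

below : ℤ → Step → Bool
below c s = (start s ≤ᵇ c) ∧ (end s ≤ᵇ c)

isUp isDown : Step → Bool
isUp s = up s
isDown s = not (up s)

ups : Path → ℕ
ups x = length (filterᵇ (λ b → b) x)

u : ℤ → Path → ℕ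
u c x = length (filterᵇ (λ s → isUp s ∧ startsOn c s) (steps x))

d : ℤ → Path → ℕ
d c x = length (filterᵇ (λ s → isDown s ∧ startsOn c s) (steps x))

-- number of down-steps of x lying below the line y = 0  (x ∈ D^e iff this is e)
downsBelow0 : Path → ℕ
downsBelow0 x = length (filterᵇ (λ s → isDown s ∧ below (+ 0) s) (steps x))

-- n-th element (0-based)
nth : {A : Set} → ℕ → List A → Maybe A
nth n [] = nothing
nth zero (a ∷ as) = just a
nth (suc n) (a ∷ as) = nth n as

-- replace the step at position p (1-based) by b
setAt : ℕ → Bool → Path → Path
setAt p b [] = []
setAt zero b (c ∷ cs) = c ∷ cs
setAt (suc zero) b (c ∷ cs) = b ∷ cs
setAt (suc (suc p)) b (c ∷ cs) = c ∷ setAt (suc p) b cs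

-- pos(g,x): position of the (d_0(x)+1)-th (from the left) down-step of x touching y = 0
posG : Path → Maybe ℕ
posG x = nth (d (+ 0) x) (map pos (filterᵇ (λ s → isDown s ∧ touches (+ 0) s) (steps x)))

-- pos(h,x): position of the u_1(x)-th (from the left) up-step of x touching y = 1
posH : Path → Maybe ℕ
posH x with u (+ 1) x
... | zero = nothing
... | suc m = nth m (map pos (filterᵇ (λ s → isUp s ∧ touches (+ 1) s) (steps x)))

g : Path → Path
g x with posG x
... | just p = setAt p true x
... | nothing = x

h : Path → Path
h x with posH x
... | just p = setAt p false x
... | nothing = x

upTouching1At : Path → ℕ → Set
upTouching1At x i = Any (λ s → pos s ≡ i × T (isUp s ∧ touches (+ 1) s)) (steps x)

module Submission where

-- Let x = pre ++ ↓ ∷ post, where ↓ is the (d₀(x)+1)-th down-step touching y = 0, the step that g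
-- turns into an up-step; ↓ starts at height 0 or 1. Up- and down-crossings of the edge between two
-- levels alternate. Along pre this, together with the choice of ↓, shows that pre has one more
-- up-step from 0 than post has down-steps from 0; along post, which returns to 0 in x and which g
-- lifts by 2, it shows that after pre the path g(x) has just as many up-steps from 1. Hence u₁(g x)
-- is the number of up-steps of pre touching y = 1, so pos(h, g x) is the last such step of pre: it
-- precedes ↓, and x and g(x), which agree on pre, have no up-step touching y = 1 in between.

open import Defs
open import Algebra.Bundles using (AbelianGroup)
import Algebra.Properties.CommutativeSemigroup as CommutativeSemigroupProperties
import Algebra.Properties.Group as GroupProperties
open import Data.Bool using (Bool; true; false; _∧_; _∨_; not; T; if_then_else_)
open import Data.Empty using (⊥-elim)
open import Data.Integer as ℤ using (ℤ; -[1+_]; +≤+; -≤+; 0ℤ; 1ℤ; -1ℤ)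
import Data.Integer.Properties as ℤP
open import Data.List using ([]; _∷_; _++_; length; map; filterᵇ)
open import Data.List.Properties using (length-++; ++-assoc)
open import Data.List.Relation.Unary.Any using (Any; here; there)
open import Data.List.Relation.Unary.Any.Properties using (++⁻)
open import Data.Maybe using (just)
open import Data.Nat using (ℕ; zero; suc; _+_; _*_; _≤_; _<_; _≥_; z≤n; s≤s; s≤s⁻¹)
open import Data.Nat.Properties
  using (+-assoc; +-comm; +-suc; +-identityʳ; +-cancelˡ-≡; suc-injective; m+n≡0⇒m≡0; m+n≡0⇒n≡0;
         ≤-refl; ≤-trans; n≤1+n; <⇒≤; <⇒≱; <-irrefl; m<m+n; m≤m+n; +-commutativeSemigroup)
open import Data.Product using (Σ; _×_; _,_; ∃-syntax)
open import Data.Sum using (_⊎_; inj₁; inj₂)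
open import Data.Unit using (tt)
open import Function using (_∘_)
open import Function.Bundles using (_⇔_; mk⇔)
open import Relation.Binary.PropositionalEquality
  using (_≡_; _≢_; refl; sym; trans; cong; cong₂; subst; subst₂; module ≡-Reasoning)
open import Relation.Nullary using (¬_)
open import Relation.Nullary.Decidable
  using (Dec; ⌊_⌋; does; yes; no; dec-true; dec-false; does-⇔; isYes≗does)

private
  module ℕS = CommutativeSemigroupProperties +-commutativeSemigroup
  module ℤS = CommutativeSemigroupProperties ℤP.+-commutativeSemigroup
  module ℤG = GroupProperties (AbelianGroup.group ℤP.+-0-abelianGroup)

toℕ : Bool → ℕ
toℕ true = 1
toℕ false = 0

T⇒toℕ≡1 : ∀ {b} → T b → toℕ b ≡ 1
T⇒toℕ≡1 {true} _ = refl

toℕ≡0⇒¬T : ∀ {b} → toℕ b ≡ 0 → ¬ T b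
toℕ≡0⇒¬T {false} _ ()

next : Bool → ℤ → ℤ
next b h = if b then h ℤ.+ 1ℤ else h ℤ.- 1ℤ

endHeight : ℤ → Path → ℤ
endHeight h [] = h
endHeight h (b ∷ bs) = endHeight (next b h) bs

endHeight-++ : ∀ h xs ys → endHeight h (xs ++ ys) ≡ endHeight (endHeight h xs) ys
endHeight-++ h [] ys = refl
endHeight-++ h (b ∷ xs) ys = endHeight-++ (next b h) xs ys

next-+ : ∀ b h δ → next b (h ℤ.+ δ) ≡ next b h ℤ.+ δ
next-+ true h δ = ℤS.xy∙z≈xz∙y h δ 1ℤ
next-+ false h δ = ℤS.xy∙z≈xz∙y h δ -1ℤ

i-1+1≡i : ∀ h → (h ℤ.- 1ℤ) ℤ.+ 1ℤ ≡ h
i-1+1≡i h = trans (ℤP.+-assoc h -1ℤ 1ℤ) (ℤP.+-identityʳ h)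

⌊⌋-⇔ : ∀ {A B : Set} → A ⇔ B → (a? : Dec A) (b? : Dec B) → ⌊ a? ⌋ ≡ ⌊ b? ⌋
⌊⌋-⇔ A⇔B a? b? = trans (isYes≗does a?) (trans (does-⇔ A⇔B a? b?) (sym (isYes≗does b?)))

==ℤ-+ʳ : ∀ a b δ → ((a ℤ.+ δ) ==ℤ (b ℤ.+ δ)) ≡ (a ==ℤ b)
==ℤ-+ʳ a b δ = ⌊⌋-⇔ (mk⇔ (ℤG.∙-cancelʳ δ a b) (cong (ℤ._+ δ))) _ (a ℤP.≟ b)

StepPred : Set
StepPred = Bool → ℤ → Bool

count : StepPred → ℤ → Path → ℕ
count P h [] = 0
count P h (b ∷ bs) = toℕ (P b h) + count P (next b h) bs

count-++ : ∀ P h xs ys → count P h (xs ++ ys) ≡ count P h xs + count P (endHeight h xs) ys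
count-++ P h [] ys = refl
count-++ P h (b ∷ xs) ys =
  trans (cong (toℕ (P b h) +_) (count-++ P (next b h) xs ys)) (sym (+-assoc (toℕ (P b h)) _ _))

count-sum : ∀ {R P Q : StepPred} → (∀ b h → toℕ (R b h) ≡ toℕ (P b h) + toℕ (Q b h)) →
  ∀ h x → count R h x ≡ count P h x + count Q h x
count-sum R≡P+Q h [] = refl
count-sum {R} {P} {Q} R≡P+Q h (b ∷ bs) =
  trans (cong₂ _+_ (R≡P+Q b h) (count-sum {R} {P} {Q} R≡P+Q (next b h) bs))
    (ℕS.interchange (toℕ (P b h)) (toℕ (Q b h)) _ _)

count-shift : ∀ {P Q : StepPred} δ → (∀ b h → P b (h ℤ.+ δ) ≡ Q b h) →
  ∀ h x → count P (h ℤ.+ δ) x ≡ count Q h x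
count-shift δ P≡Q h [] = refl
count-shift {P} δ P≡Q h (b ∷ bs) =
  cong₂ _+_ (cong toℕ (P≡Q b h))
    (trans (cong (λ h′ → count P h′ bs) (next-+ b h δ)) (count-shift δ P≡Q (next b h) bs))

-- Q, a predicate on steps as in Defs, depends only on direction and starting height, through P.
-- Since next is the height update of stepsFrom, the instances below hold by refl.
_Describes_ : StepPred → (Step → Bool) → Set
P Describes Q = ∀ j b h → Q (step j b h (next b h)) ≡ P b h

length-filterᵇ-stepsFrom : ∀ {P Q} → P Describes Q →
  ∀ i h x → length (filterᵇ Q (stepsFrom i h x)) ≡ count P h x
length-filterᵇ-stepsFrom P∼Q i h [] = refl
length-filterᵇ-stepsFrom {P} {Q} P∼Q i h (b ∷ bs)
  with Q (step i b h (next b h)) | P b h | P∼Q i b h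
... | true  | .true  | refl = cong suc (length-filterᵇ-stepsFrom P∼Q (suc i) (next b h) bs)
... | false | .false | refl = length-filterᵇ-stepsFrom P∼Q (suc i) (next b h) bs

upFrom downFrom : ℤ → StepPred
upFrom c b h = b ∧ (h ==ℤ c)
downFrom c b h = not b ∧ (h ==ℤ c)

downTouching0 upTouching1 downBelow0 : StepPred
downTouching0 b h = not b ∧ ((h ==ℤ 0ℤ) ∨ (next b h ==ℤ 0ℤ))
upTouching1 b h = b ∧ ((h ==ℤ 1ℤ) ∨ (next b h ==ℤ 1ℤ))
downBelow0 b h = not b ∧ ((h ℤ.≤ᵇ 0ℤ) ∧ (next b h ℤ.≤ᵇ 0ℤ))

upFrom-describes : ∀ c → upFrom c Describes (λ s → isUp s ∧ startsOn c s)
upFrom-describes c _ _ _ = refl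

downFrom-describes : ∀ c → downFrom c Describes (λ s → isDown s ∧ startsOn c s)
downFrom-describes c _ _ _ = refl

downTouching0-describes : downTouching0 Describes (λ s → isDown s ∧ touches 0ℤ s)
downTouching0-describes _ _ _ = refl

upTouching1-describes : upTouching1 Describes (λ s → isUp s ∧ touches 1ℤ s)
upTouching1-describes _ _ _ = refl

downBelow0-describes : downBelow0 Describes (λ s → isDown s ∧ below 0ℤ s)
downBelow0-describes _ _ _ = refl

downTouching0≡downFrom0+downFrom1 : ∀ h x →
  count downTouching0 h x ≡ count (downFrom 0ℤ) h x + count (downFrom 1ℤ) h x
downTouching0≡downFrom0+downFrom1 = count-sum pointwise
  where
  pointwise : ∀ b h → toℕ (downTouching0 b h) ≡ toℕ (downFrom 0ℤ b h) + toℕ (downFrom 1ℤ b h)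
  pointwise true h = refl
  pointwise false (ℤ.+ zero) = refl
  pointwise false (ℤ.+ suc zero) = refl
  pointwise false (ℤ.+ suc (suc n)) = refl
  pointwise false -[1+ n ] = refl

upTouching1≡upFrom1+upFrom0 : ∀ h x →
  count upTouching1 h x ≡ count (upFrom 1ℤ) h x + count (upFrom 0ℤ) h x
upTouching1≡upFrom1+upFrom0 = count-sum pointwise
  where
  pointwise : ∀ b h → toℕ (upTouching1 b h) ≡ toℕ (upFrom 1ℤ b h) + toℕ (upFrom 0ℤ b h)
  pointwise false h = refl
  pointwise true (ℤ.+ zero) = refl
  pointwise true (ℤ.+ suc zero) = refl
  pointwise true (ℤ.+ suc (suc n)) = refl
  pointwise true -[1+ zero ] = refl
  pointwise true -[1+ suc n ] = refl

downTouching0-start : ∀ {b h} → T (downTouching0 b h) → b ≡ false × (h ≡ 0ℤ ⊎ h ≡ 1ℤ)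
downTouching0-start {false} {ℤ.+ zero} _ = refl , inj₁ refl
downTouching0-start {false} {ℤ.+ suc zero} _ = refl , inj₂ refl
downTouching0-start {false} {ℤ.+ suc (suc n)} ()
downTouching0-start {false} { -[1+ n ]} ()

above : ℤ → ℤ → ℕ
above c h = toℕ (does (c ℤP.<? h))

i<i+1 : ∀ h → h ℤ.< h ℤ.+ 1ℤ
i<i+1 h = ℤP.suc[i]≤j⇒i<j (ℤP.≤-reflexive (ℤP.+-comm 1ℤ h))

above-up : ∀ c h → toℕ (h ==ℤ c) + above c h ≡ above c (h ℤ.+ 1ℤ)
above-up c h with h ℤP.≟ c
... | yes refl
  rewrite dec-false (h ℤP.<? h) (ℤP.<-irrefl refl) | dec-true (h ℤP.<? h ℤ.+ 1ℤ) (i<i+1 h) = refl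
... | no h≢c =
  cong toℕ (does-⇔ (mk⇔ (λ c<h → ℤP.<-trans c<h (i<i+1 h)) c<h+1⇒c<h) (c ℤP.<? h) (c ℤP.<? h ℤ.+ 1ℤ))
  where
  c<h+1⇒c<h : c ℤ.< h ℤ.+ 1ℤ → c ℤ.< h
  c<h+1⇒c<h c<h+1 = ℤP.≤∧≢⇒< (subst (c ℤ.≤_) pred[h+1]≡h (ℤP.i<j⇒i≤pred[j] c<h+1)) (h≢c ∘ sym)
    where
    pred[h+1]≡h : ℤ.pred (h ℤ.+ 1ℤ) ≡ h
    pred[h+1]≡h = trans (ℤP.+-comm -1ℤ (h ℤ.+ 1ℤ)) (trans (ℤS.xy∙z≈xz∙y h 1ℤ -1ℤ) (i-1+1≡i h))

above-down : ∀ c h → above c h ≡ toℕ (h ==ℤ (c ℤ.+ 1ℤ)) + above c (h ℤ.- 1ℤ)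
above-down c h = begin
  above c h                                             ≡⟨ cong (above c) (sym (i-1+1≡i h)) ⟩
  above c ((h ℤ.- 1ℤ) ℤ.+ 1ℤ)                           ≡⟨ sym (above-up c (h ℤ.- 1ℤ)) ⟩
  toℕ ((h ℤ.- 1ℤ) ==ℤ c) + above c (h ℤ.- 1ℤ)
    ≡⟨ cong (λ t → toℕ t + above c (h ℤ.- 1ℤ)) shift ⟩
  toℕ (h ==ℤ (c ℤ.+ 1ℤ)) + above c (h ℤ.- 1ℤ)          ∎
  where
  open ≡-Reasoning
  shift : ((h ℤ.- 1ℤ) ==ℤ c) ≡ (h ==ℤ (c ℤ.+ 1ℤ))
  shift = trans (sym (==ℤ-+ʳ (h ℤ.- 1ℤ) c 1ℤ)) (cong (_==ℤ (c ℤ.+ 1ℤ)) (i-1+1≡i h))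

-- Crossings of the edge between the levels c and c + 1 alternate between up and down.
crossing : ∀ c h x →
  count (upFrom c) h x + above c h ≡ count (downFrom (c ℤ.+ 1ℤ)) h x + above c (endHeight h x)
crossing c h [] = refl
crossing c h (true ∷ bs) = begin
  toℕ (h ==ℤ c) + U + above c h      ≡⟨ ℕS.xy∙z≈y∙xz (toℕ (h ==ℤ c)) U _ ⟩
  U + (toℕ (h ==ℤ c) + above c h)    ≡⟨ cong (U +_) (above-up c h) ⟩
  U + above c (h ℤ.+ 1ℤ)             ≡⟨ crossing c (h ℤ.+ 1ℤ) bs ⟩
  D + above c (endHeight h (true ∷ bs)) ∎
  where
  open ≡-Reasoning
  U = count (upFrom c) (h ℤ.+ 1ℤ) bs
  D = count (downFrom (c ℤ.+ 1ℤ)) (h ℤ.+ 1ℤ) bs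
crossing c h (false ∷ bs) = begin
  U + above c h                            ≡⟨ cong (U +_) (above-down c h) ⟩
  U + (t + above c (h ℤ.- 1ℤ))             ≡⟨ ℕS.x∙yz≈y∙xz U t _ ⟩
  t + (U + above c (h ℤ.- 1ℤ))             ≡⟨ cong (t +_) (crossing c (h ℤ.- 1ℤ) bs) ⟩
  t + (D + above c (endHeight h (false ∷ bs))) ≡⟨ sym (+-assoc t D _) ⟩
  t + D + above c (endHeight h (false ∷ bs)) ∎
  where
  open ≡-Reasoning
  U = count (upFrom c) (h ℤ.- 1ℤ) bs
  D = count (downFrom (c ℤ.+ 1ℤ)) (h ℤ.- 1ℤ) bs
  t = toℕ (h ==ℤ (c ℤ.+ 1ℤ))

downs : Path → ℕ
downs x = length (filterᵇ not x)

length≡ups+downs : ∀ x → length x ≡ ups x + downs x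
length≡ups+downs [] = refl
length≡ups+downs (true ∷ bs) = cong suc (length≡ups+downs bs)
length≡ups+downs (false ∷ bs) =
  trans (cong suc (length≡ups+downs bs)) (sym (+-suc (ups bs) (downs bs)))

endHeight+downs≡start+ups : ∀ h x → endHeight h x ℤ.+ ℤ.+ downs x ≡ h ℤ.+ ℤ.+ ups x
endHeight+downs≡start+ups h [] = refl
endHeight+downs≡start+ups h (true ∷ bs) =
  trans (endHeight+downs≡start+ups (h ℤ.+ 1ℤ) bs) (ℤP.+-assoc h 1ℤ (ℤ.+ ups bs))
endHeight+downs≡start+ups h (false ∷ bs) = begin
  e ℤ.+ (1ℤ ℤ.+ ℤ.+ downs bs)       ≡⟨ ℤS.x∙yz≈xz∙y e 1ℤ _ ⟩
  e ℤ.+ ℤ.+ downs bs ℤ.+ 1ℤ         ≡⟨ cong (ℤ._+ 1ℤ) (endHeight+downs≡start+ups (h ℤ.- 1ℤ) bs) ⟩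
  h ℤ.- 1ℤ ℤ.+ ℤ.+ ups bs ℤ.+ 1ℤ   ≡⟨ cong (ℤ._+ 1ℤ) (ℤS.xy∙z≈xz∙y h -1ℤ _) ⟩
  h ℤ.+ ℤ.+ ups bs ℤ.- 1ℤ ℤ.+ 1ℤ   ≡⟨ i-1+1≡i _ ⟩
  h ℤ.+ ℤ.+ ups bs                 ∎
  where
  open ≡-Reasoning
  e = endHeight (h ℤ.- 1ℤ) bs

downs≡k×endHeight≡0 : ∀ k x → length x ≡ 2 * k → ups x ≡ k → downs x ≡ k × endHeight 0ℤ x ≡ 0ℤ
downs≡k×endHeight≡0 k x |x|≡2k ups≡k = downs≡k , ℤG.∙-cancelʳ (ℤ.+ k) _ _ end+k≡0+k
  where
  downs≡k : downs x ≡ k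
  downs≡k = +-cancelˡ-≡ k (downs x) k (begin
    k + downs x      ≡⟨ cong (_+ downs x) ups≡k ⟨
    ups x + downs x  ≡⟨ length≡ups+downs x ⟨
    length x         ≡⟨ |x|≡2k ⟩
    k + (k + 0)      ≡⟨ cong (k +_) (+-identityʳ k) ⟩
    k + k            ∎)
    where open ≡-Reasoning
  end+k≡0+k : endHeight 0ℤ x ℤ.+ ℤ.+ k ≡ 0ℤ ℤ.+ ℤ.+ k
  end+k≡0+k = subst₂ (λ d u → endHeight 0ℤ x ℤ.+ ℤ.+ d ≡ 0ℤ ℤ.+ ℤ.+ u) downs≡k ups≡k
    (endHeight+downs≡start+ups 0ℤ x)

noUpFrom0⇒allDownsBelow0 : ∀ h x → h ℤ.≤ 0ℤ → count (upFrom 0ℤ) h x ≡ 0 →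
  count downBelow0 h x ≡ downs x
noUpFrom0⇒allDownsBelow0 h [] _ _ = refl
noUpFrom0⇒allDownsBelow0 (ℤ.+ zero) (true ∷ bs) _ ()
noUpFrom0⇒allDownsBelow0 (ℤ.+ zero) (false ∷ bs) _ none =
  cong suc (noUpFrom0⇒allDownsBelow0 -1ℤ bs -≤+ none)
noUpFrom0⇒allDownsBelow0 -[1+ zero ] (true ∷ bs) _ none =
  noUpFrom0⇒allDownsBelow0 0ℤ bs ℤP.≤-refl none
noUpFrom0⇒allDownsBelow0 -[1+ suc n ] (true ∷ bs) _ none =
  noUpFrom0⇒allDownsBelow0 -[1+ n ] bs -≤+ none
noUpFrom0⇒allDownsBelow0 -[1+ n ] (false ∷ bs) _ none =
  cong suc (noUpFrom0⇒allDownsBelow0 _ bs -≤+ none)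
noUpFrom0⇒allDownsBelow0 (ℤ.+ suc n) _ (+≤+ ())

splitAtCount : ∀ P h x n → n < count P h x →
  ∃[ pre ] ∃[ b ] ∃[ post ] x ≡ pre ++ b ∷ post × count P h pre ≡ n × T (P b (endHeight h pre))
splitAtCount P h [] n ()
splitAtCount P h (b ∷ bs) n n< with P b h in Pbh
splitAtCount P h (b ∷ bs) zero _ | true = [] , b , bs , refl , refl , subst T (sym Pbh) tt
splitAtCount P h (b ∷ bs) (suc n) n< | true
  with splitAtCount P (next b h) bs n (s≤s⁻¹ n<)
... | pre , c , post , refl , count≡n , t =
  b ∷ pre , c , post , refl , cong₂ _+_ (cong toℕ Pbh) count≡n , t
splitAtCount P h (b ∷ bs) n n< | false
  with splitAtCount P (next b h) bs n n<
... | pre , c , post , refl , count≡n , t =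
  b ∷ pre , c , post , refl , cong₂ _+_ (cong toℕ Pbh) count≡n , t

splitAtLastCount : ∀ P h x m → count P h x ≡ suc m →
  ∃[ pre ] ∃[ b ] ∃[ post ] x ≡ pre ++ b ∷ post × count P h pre ≡ m × T (P b (endHeight h pre))
    × count P (next b (endHeight h pre)) post ≡ 0
splitAtLastCount P h x m count≡1+m
  with splitAtCount P h x m (subst (m <_) (sym count≡1+m) ≤-refl)
... | pre , b , post , refl , count-pre , t = pre , b , post , refl , count-pre , t , none
  where
  c = count P (next b (endHeight h pre)) post
  m+1+c≡m+1 : m + suc c ≡ m + 1
  m+1+c≡m+1 = begin
    m + suc c                                         ≡⟨ cong (λ n → m + (n + c)) (sym (T⇒toℕ≡1 t)) ⟩
    m + count P (endHeight h pre) (b ∷ post)           ≡⟨ cong (_+ _) (sym count-pre) ⟩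
    count P h pre + count P (endHeight h pre) (b ∷ post) ≡⟨ sym (count-++ P h pre (b ∷ post)) ⟩
    count P h (pre ++ b ∷ post)                        ≡⟨ count≡1+m ⟩
    suc m                                              ≡⟨ +-comm 1 m ⟩
    m + 1                                              ∎
    where open ≡-Reasoning
  none : c ≡ 0
  none = suc-injective (+-cancelˡ-≡ m (suc c) 1 m+1+c≡m+1)

stepsFrom-++ : ∀ i h xs ys →
  stepsFrom i h (xs ++ ys) ≡ stepsFrom i h xs ++ stepsFrom (i + length xs) (endHeight h xs) ys
stepsFrom-++ i h [] ys = cong (λ j → stepsFrom j h ys) (sym (+-identityʳ i))
stepsFrom-++ i h (b ∷ xs) ys =
  cong (step i b h (next b h) ∷_)
    (trans (stepsFrom-++ (suc i) (next b h) xs ys)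
      (cong (λ j → stepsFrom (suc i) (next b h) xs ++ stepsFrom j (endHeight (next b h) xs) ys)
        (sym (+-suc i (length xs)))))

module _ {X : Step → Set} {j : ℕ} where

  pos-≥ : ∀ {i h} x → Any (λ s → pos s ≡ j × X s) (stepsFrom i h x) → i ≤ j
  pos-≥ (b ∷ bs) (here (refl , _)) = ≤-refl
  pos-≥ {i} (b ∷ bs) (there any) = ≤-trans (n≤1+n i) (pos-≥ bs any)

  pos-< : ∀ {i h} x → Any (λ s → pos s ≡ j × X s) (stepsFrom i h x) → j < i + length x
  pos-< {i} (b ∷ bs) (here (refl , _)) =
    subst (i <_) (sym (+-suc i (length bs))) (s≤s (m≤m+n i (length bs)))
  pos-< {i} (b ∷ bs) (there any) = subst (j <_) (sym (+-suc i (length bs))) (pos-< bs any)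

nth-map-filterᵇ : ∀ {A B : Set} (f : A → B) (Q : A → Bool) xs a ys → T (Q a) →
  nth (length (filterᵇ Q xs)) (map f (filterᵇ Q (xs ++ a ∷ ys))) ≡ just (f a)
nth-map-filterᵇ f Q [] a ys t with Q a
... | true = refl
nth-map-filterᵇ f Q (x ∷ xs) a ys t with Q x
... | true = nth-map-filterᵇ f Q xs a ys t
... | false = nth-map-filterᵇ f Q xs a ys t

nth-pos-filterᵇ : ∀ {P Q} → P Describes Q → ∀ i h pre b post → T (P b (endHeight h pre)) →
  nth (count P h pre) (map pos (filterᵇ Q (stepsFrom i h (pre ++ b ∷ post)))) ≡ just (i + length pre)
nth-pos-filterᵇ {P} {Q} P∼Q i h pre b post t = begin
  nth (count P h pre) (map pos (filterᵇ Q (stepsFrom i h (pre ++ b ∷ post))))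
    ≡⟨ cong₂ (λ n l → nth n (map pos (filterᵇ Q l)))
         (sym (length-filterᵇ-stepsFrom P∼Q i h pre)) (stepsFrom-++ i h pre (b ∷ post)) ⟩
  nth (length (filterᵇ Q (stepsFrom i h pre))) (map pos (filterᵇ Q (stepsFrom i h pre ++ s ∷ _)))
    ≡⟨ nth-map-filterᵇ pos Q (stepsFrom i h pre) s _ (subst T (sym (P∼Q _ b _)) t) ⟩
  just (i + length pre) ∎
  where
  open ≡-Reasoning
  s = step (i + length pre) b (endHeight h pre) (next b (endHeight h pre))

count≡0⇒¬step : ∀ {P Q} → P Describes Q → ∀ {i h j} x → count P h x ≡ 0 →
  ¬ Any (λ s → pos s ≡ j × T (Q s)) (stepsFrom i h x)
count≡0⇒¬step P∼Q (b ∷ bs) none (here (_ , t)) =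
  toℕ≡0⇒¬T (m+n≡0⇒m≡0 _ none) (subst T (P∼Q _ b _) t)
count≡0⇒¬step P∼Q (b ∷ bs) none (there any) = count≡0⇒¬step P∼Q bs (m+n≡0⇒n≡0 _ none) any

noStepBetween : ∀ {P Q} → P Describes Q → ∀ {i h} pre₁ b pre₂ rest {j} →
  count P (next b (endHeight h pre₁)) pre₂ ≡ 0 →
  i + length pre₁ < j → j < i + length (pre₁ ++ b ∷ pre₂) →
  ¬ Any (λ s → pos s ≡ j × T (Q s)) (stepsFrom i h ((pre₁ ++ b ∷ pre₂) ++ rest))
noStepBetween P∼Q {i} {h} pre₁ b pre₂ rest none q<j j<p any
  with ++⁻ (stepsFrom i h (pre₁ ++ b ∷ pre₂))
         (subst (Any _) (stepsFrom-++ i h (pre₁ ++ b ∷ pre₂) rest) any)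
... | inj₂ inRest = <⇒≱ j<p (pos-≥ rest inRest)
... | inj₁ inPre
  with ++⁻ (stepsFrom i h pre₁) (subst (Any _) (stepsFrom-++ i h pre₁ (b ∷ pre₂)) inPre)
...   | inj₁ inPre₁ = <⇒≱ q<j (<⇒≤ (pos-< pre₁ inPre₁))
...   | inj₂ (here (refl , _)) = <-irrefl refl q<j
...   | inj₂ (there inPre₂) = count≡0⇒¬step P∼Q pre₂ none inPre₂

setAt-++ : ∀ pre b c post → setAt (suc (length pre)) b (pre ++ c ∷ post) ≡ pre ++ b ∷ post
setAt-++ [] b c post = refl
setAt-++ (x ∷ pre) b c post = cong (x ∷_) (setAt-++ pre b c post)

g≡setAt : ∀ x {p} → posG x ≡ just p → g x ≡ setAt p true x
g≡setAt x posG≡p rewrite posG≡p = refl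

posG-split : ∀ pre b post → count downTouching0 0ℤ pre ≡ d 0ℤ (pre ++ b ∷ post) →
  T (downTouching0 b (endHeight 0ℤ pre)) → posG (pre ++ b ∷ post) ≡ just (suc (length pre))
posG-split pre b post count≡d t =
  trans (cong (λ n → nth n (map pos (filterᵇ Q (steps (pre ++ b ∷ post))))) (sym count≡d))
    (nth-pos-filterᵇ downTouching0-describes 1 0ℤ pre b post t)
  where Q = λ s → isDown s ∧ touches 0ℤ s

posH-split : ∀ pre b rest {m} → u 1ℤ (pre ++ b ∷ rest) ≡ suc m → count upTouching1 0ℤ pre ≡ m →
  T (upTouching1 b (endHeight 0ℤ pre)) → posH (pre ++ b ∷ rest) ≡ just (suc (length pre))
posH-split pre b rest u≡1+m count≡m t rewrite u≡1+m =
  trans (cong (λ n → nth n (map pos (filterᵇ Q (steps (pre ++ b ∷ rest))))) (sym count≡m))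
    (nth-pos-filterᵇ upTouching1-describes 1 0ℤ pre b rest t)
  where Q = λ s → isUp s ∧ touches 1ℤ s

upFrom0-before-flip : ∀ pre post {hp} → endHeight 0ℤ pre ≡ hp → hp ≡ 0ℤ ⊎ hp ≡ 1ℤ →
  count downTouching0 0ℤ pre ≡ count (downFrom 0ℤ) 0ℤ (pre ++ false ∷ post) →
  count (upFrom 0ℤ) 0ℤ pre ≡ suc (count (downFrom 0ℤ) (hp ℤ.- 1ℤ) post)
upFrom0-before-flip pre post {hp} end≡hp hp∈ count≡ = begin
  U                                        ≡⟨ sym (+-identityʳ U) ⟩
  U + 0                                    ≡⟨ crossing 0ℤ 0ℤ pre ⟩
  B + above 0ℤ (endHeight 0ℤ pre)          ≡⟨ cong₂ (λ n e → n + above 0ℤ e) B≡ end≡hp ⟩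
  toℕ (hp ==ℤ 0ℤ) + A + above 0ℤ hp        ≡⟨ ℕS.xy∙z≈y∙xz (toℕ (hp ==ℤ 0ℤ)) A (above 0ℤ hp) ⟩
  A + (toℕ (hp ==ℤ 0ℤ) + above 0ℤ hp)      ≡⟨ cong (A +_) (at-0-or-1 hp∈) ⟩
  A + 1                                    ≡⟨ +-comm A 1 ⟩
  suc A                                    ∎
  where
  open ≡-Reasoning
  U = count (upFrom 0ℤ) 0ℤ pre
  B = count (downFrom 1ℤ) 0ℤ pre
  A = count (downFrom 0ℤ) (hp ℤ.- 1ℤ) post
  B≡ : B ≡ toℕ (hp ==ℤ 0ℤ) + A
  B≡ = +-cancelˡ-≡ (count (downFrom 0ℤ) 0ℤ pre) B (toℕ (hp ==ℤ 0ℤ) + A) (begin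
    count (downFrom 0ℤ) 0ℤ pre + B   ≡⟨ sym (downTouching0≡downFrom0+downFrom1 0ℤ pre) ⟩
    count downTouching0 0ℤ pre       ≡⟨ count≡ ⟩
    count (downFrom 0ℤ) 0ℤ (pre ++ false ∷ post) ≡⟨ count-++ (downFrom 0ℤ) 0ℤ pre (false ∷ post) ⟩
    count (downFrom 0ℤ) 0ℤ pre + count (downFrom 0ℤ) (endHeight 0ℤ pre) (false ∷ post)
      ≡⟨ cong (λ e → count (downFrom 0ℤ) 0ℤ pre + count (downFrom 0ℤ) e (false ∷ post)) end≡hp ⟩
    count (downFrom 0ℤ) 0ℤ pre + (toℕ (hp ==ℤ 0ℤ) + A) ∎)
  at-0-or-1 : ∀ {h} → h ≡ 0ℤ ⊎ h ≡ 1ℤ → toℕ (h ==ℤ 0ℤ) + above 0ℤ h ≡ 1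
  at-0-or-1 (inj₁ refl) = refl
  at-0-or-1 (inj₂ refl) = refl

upFrom1-after-flip : ∀ post {hp} → hp ≡ 0ℤ ⊎ hp ≡ 1ℤ → endHeight (hp ℤ.- 1ℤ) post ≡ 0ℤ →
  count (upFrom 1ℤ) hp (true ∷ post) ≡ suc (count (downFrom 0ℤ) (hp ℤ.- 1ℤ) post)
upFrom1-after-flip post {hp} hp∈ end≡0 = begin
  count (upFrom 1ℤ) hp (true ∷ post)                   ≡⟨ first-step hp∈ ⟩
  above -1ℤ h₀ + count (upFrom 1ℤ) (h₀ ℤ.+ ℤ.+ 2) post
    ≡⟨ cong (above -1ℤ h₀ +_) (count-shift (ℤ.+ 2) shift h₀ post) ⟩
  above -1ℤ h₀ + U                                     ≡⟨ +-comm (above -1ℤ h₀) U ⟩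
  U + above -1ℤ h₀                                     ≡⟨ crossing -1ℤ h₀ post ⟩
  A + above -1ℤ (endHeight h₀ post)                    ≡⟨ cong (λ e → A + above -1ℤ e) end≡0 ⟩
  A + 1                                                ≡⟨ +-comm A 1 ⟩
  suc A                                                ∎
  where
  open ≡-Reasoning
  h₀ = hp ℤ.- 1ℤ
  U = count (upFrom -1ℤ) h₀ post
  A = count (downFrom 0ℤ) h₀ post
  -- g lifts post by 2, so its up-steps from 1 in g x are its up-steps from -1 in x.
  shift : ∀ b h → upFrom 1ℤ b (h ℤ.+ ℤ.+ 2) ≡ upFrom -1ℤ b h
  shift b h = cong (b ∧_) (==ℤ-+ʳ h -1ℤ (ℤ.+ 2))
  first-step : hp ≡ 0ℤ ⊎ hp ≡ 1ℤ →
    count (upFrom 1ℤ) hp (true ∷ post) ≡ above -1ℤ h₀ + count (upFrom 1ℤ) (h₀ ℤ.+ ℤ.+ 2) post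
  first-step (inj₁ refl) = refl
  first-step (inj₂ refl) = refl

downFrom1-positive : ∀ x → endHeight 0ℤ x ≡ 0ℤ → count downBelow0 0ℤ x ≢ downs x →
  0 < count (downFrom 1ℤ) 0ℤ x
downFrom1-positive x end≡0 notAllBelow with count (downFrom 1ℤ) 0ℤ x in B≡
... | suc _ = s≤s z≤n
... | zero = ⊥-elim (notAllBelow (noUpFrom0⇒allDownsBelow0 0ℤ x ℤP.≤-refl U≡0))
  where
  U≡0 : count (upFrom 0ℤ) 0ℤ x ≡ 0
  U≡0 = trans (sym (+-identityʳ _))
    (trans (crossing 0ℤ 0ℤ x) (cong₂ (λ n e → n + above 0ℤ e) B≡ end≡0))

g-split : ∀ x → endHeight 0ℤ x ≡ 0ℤ → 0 < count (downFrom 1ℤ) 0ℤ x →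
  ∃[ pre ] ∃[ post ] x ≡ pre ++ false ∷ post × posG x ≡ just (suc (length pre))
    × ∃[ m ] u 1ℤ (pre ++ true ∷ post) ≡ suc m × count upTouching1 0ℤ pre ≡ suc m
g-split x end≡0 B>0
  with splitAtCount downTouching0 0ℤ x (count (downFrom 0ℤ) 0ℤ x)
         (subst (count (downFrom 0ℤ) 0ℤ x <_) (sym (downTouching0≡downFrom0+downFrom1 0ℤ x))
           (m<m+n _ B>0))
... | pre , b , post , refl , count≡ , t with downTouching0-start {b} t
... | refl , hp∈ =
  pre , post , refl , posG-split pre false post (trans count≡ (sym d≡)) t ,
  U1 + A , trans u≡ (+-suc U1 A) , trans touching≡ (+-suc U1 A)
  where
  x′ = pre ++ false ∷ post
  y = pre ++ true ∷ post
  hp = endHeight 0ℤ pre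
  U1 = count (upFrom 1ℤ) 0ℤ pre
  A = count (downFrom 0ℤ) (hp ℤ.- 1ℤ) post
  d≡ : d 0ℤ x′ ≡ count (downFrom 0ℤ) 0ℤ x′
  d≡ = length-filterᵇ-stepsFrom (downFrom-describes 0ℤ) 1 0ℤ x′
  post-end : endHeight (hp ℤ.- 1ℤ) post ≡ 0ℤ
  post-end = trans (sym (endHeight-++ 0ℤ pre (false ∷ post))) end≡0
  u≡ : u 1ℤ y ≡ U1 + suc A
  u≡ = begin
    u 1ℤ y                                   ≡⟨ length-filterᵇ-stepsFrom (upFrom-describes 1ℤ) 1 0ℤ y ⟩
    count (upFrom 1ℤ) 0ℤ y                   ≡⟨ count-++ (upFrom 1ℤ) 0ℤ pre (true ∷ post) ⟩
    U1 + count (upFrom 1ℤ) hp (true ∷ post)  ≡⟨ cong (U1 +_) (upFrom1-after-flip post hp∈ post-end) ⟩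
    U1 + suc A                               ∎
    where open ≡-Reasoning
  touching≡ : count upTouching1 0ℤ pre ≡ U1 + suc A
  touching≡ = trans (upTouching1≡upFrom1+upFrom0 0ℤ pre)
    (cong (U1 +_) (upFrom0-before-flip pre post refl hp∈ count≡))

lemma8 : (k : ℕ) → k ≥ 1 → (x : Path) → length x ≡ 2 * k → ups x ≡ k → downsBelow0 x ≢ k →
    Σ ℕ (λ p → Σ ℕ (λ q → posG x ≡ just p × posH (g x) ≡ just q × q < p
      × ((i : ℕ) → q < i → i < p → ¬ upTouching1At x i × ¬ upTouching1At (g x) i)))
lemma8 k _ x |x|≡2k ups≡k notAllBelow with downs≡k×endHeight≡0 k x |x|≡2k ups≡k
... | downs≡k , end≡0
  with g-split x end≡0 (downFrom1-positive x end≡0 λ allBelow →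
         notAllBelow (trans (length-filterᵇ-stepsFrom downBelow0-describes 1 0ℤ x)
                        (trans allBelow downs≡k)))
... | pre , post , refl , posG≡p , m , u≡1+m , touching≡1+m
  with splitAtLastCount upTouching1 0ℤ pre m touching≡1+m
... | pre₁ , b , pre₂ , refl , count≡m , t , none =
  suc (length pre) , suc (length pre₁) , posG≡p , posH≡q , q<p , window
  where
  reassoc = ++-assoc pre₁ (b ∷ pre₂) (true ∷ post)
  gx≡ : g (pre ++ false ∷ post) ≡ pre ++ true ∷ post
  gx≡ = trans (g≡setAt (pre ++ false ∷ post) posG≡p) (setAt-++ pre true false post)
  posH≡q : posH (g (pre ++ false ∷ post)) ≡ just (suc (length pre₁))
  posH≡q = trans (cong posH (trans gx≡ reassoc))
    (posH-split pre₁ b (pre₂ ++ true ∷ post) (trans (cong (u 1ℤ) (sym reassoc)) u≡1+m) count≡m t)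
  q<p : suc (length pre₁) < suc (length pre)
  q<p = s≤s (subst (length pre₁ <_) (sym (length-++ pre₁)) (m<m+n _ (s≤s z≤n)))
  window : ∀ i → suc (length pre₁) < i → i < suc (length pre) →
    ¬ upTouching1At (pre ++ false ∷ post) i × ¬ upTouching1At (g (pre ++ false ∷ post)) i
  window i q<i i<p =
    noStepBetween upTouching1-describes pre₁ b pre₂ (false ∷ post) none q<i i<p ,
    noStepBetween upTouching1-describes pre₁ b pre₂ (true ∷ post) none q<i i<p
      ∘ subst (λ z → upTouching1At z i) gx≡
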